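{- Let $G$ be a graph embedded on a surface, let $F\subseteq E(G)$, and let $e$ be an edge of $F$ that is not a loop. If $e^*$ is a bridge of $G^*[F^*]$, then both endpoints of $e$ belong to $\partial(F)$.
   Context: Graphs may have multiple edges and loops. $G^*$ is the dual graph of the embedded graph $G$: one vertex per face of $G$, and for each edge $e$ of $G$ a dual edge $e^*$ joining the (possibly equal) faces incident to $e$. $F^*=\{e^*: e\in F\}$, and $G^*[F^*]$ is the graph with edge set $F^*$ and vertex set the endpoints of these edges. The border $\partial(F)$ is the set of vertices of $G$ that are endpoints both of an edge in $F$ and of an edge in $E(G)\setminus F$. A bridge is an edge whose deletion increases the number of connected components. -}

module Defs where

open import Data.Nat using (ℕ; _<_)
open import Data.Fin using (Fin)
open import Data.Fin.Subset using (Subset; _∈_; _∉_)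
open import Data.Product using (Σ; ∃; _×_; _,_; proj₁)
open import Data.Sum using (_⊎_)
open import Relation.Binary.PropositionalEquality using (_≡_)
open import Relation.Binary.Construct.Closure.ReflexiveTransitive using (Star)
open import Relation.Nullary using (¬_)

-- Generic finite multigraphs given by an incidence relation.
-- Vertices Fin nv, edges Fin ne, `Inc d v` : vertex v is an endpoint of d.
-- A (sub)graph is given by a vertex set W and an edge set S.

Adj : ∀ {nv ne} → (Fin ne → Fin nv → Set) → (Fin ne → Set) →
      Fin nv → Fin nv → Set
Adj Inc S u w = ∃ λ d → S d × Inc d u × Inc d w

Connected : ∀ {nv ne} → (Fin ne → Fin nv → Set) → (Fin ne → Set) →
            Fin nv → Fin nv → Set
Connected Inc S = Star (Adj Inc S)

-- The graph (W, S) has exactly k connected components: there is a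
-- surjective labelling of its vertices by Fin k whose fibres are
-- exactly the connectivity classes.
HasComponents : ∀ {nv ne} → (Fin ne → Fin nv → Set) →
                (Fin nv → Set) → (Fin ne → Set) → ℕ → Set
HasComponents {nv} Inc W S k =
  Σ (Σ (Fin nv) W → Fin k) λ c →
    (∀ i → ∃ λ x → c x ≡ i) ×
    (∀ x y → (c x ≡ c y → Connected Inc S (proj₁ x) (proj₁ y))
           × (Connected Inc S (proj₁ x) (proj₁ y) → c x ≡ c y))

Delete : ∀ {ne} → (Fin ne → Set) → Fin ne → Fin ne → Set
Delete S d d' = S d' × ¬ d' ≡ d

IsBridge : ∀ {nv ne} → (Fin ne → Fin nv → Set) →
           (Fin nv → Set) → (Fin ne → Set) → Fin ne → Set
IsBridge Inc W S d =
  S d × (∀ k k' → HasComponents Inc W S k →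
                  HasComponents Inc W (Delete S d) k' → k < k')

-- Graphs embedded on surfaces, as graph-encoded maps (gems):
-- flags with three fixed-point-free involutions τ₀ τ₁ τ₂, τ₀τ₂ = τ₂τ₀
-- fixed-point-free.  Vertices = ⟨τ₁,τ₂⟩-orbits, edges = ⟨τ₀,τ₂⟩-orbits,
-- faces = ⟨τ₀,τ₁⟩-orbits; these are named by surjective labellings
-- whose fibres are exactly the orbits.

Step : ∀ {m} → (Fin m → Fin m) → (Fin m → Fin m) → Fin m → Fin m → Set
Step σ ρ x y = (y ≡ σ x) ⊎ (y ≡ ρ x)

Orbit : ∀ {m} → (Fin m → Fin m) → (Fin m → Fin m) → Fin m → Fin m → Set
Orbit σ ρ = Star (Step σ ρ)

record FPFInvolution {m : ℕ} (τ : Fin m → Fin m) : Set where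
  field
    invol : ∀ x → τ (τ x) ≡ x
    noFix : ∀ x → ¬ τ x ≡ x

OrbitLabelling : ∀ {m n} → (Fin m → Fin m) → (Fin m → Fin m) →
                 (Fin m → Fin n) → Set
OrbitLabelling {m} {n} σ ρ lab =
  (∀ i → ∃ λ x → lab x ≡ i) ×
  (∀ x y → (lab x ≡ lab y → Orbit σ ρ x y) × (Orbit σ ρ x y → lab x ≡ lab y))

record EmbeddedGraph : Set where
  field
    nFlags nV nE nFaces : ℕ
    τ₀ τ₁ τ₂ : Fin nFlags → Fin nFlags
    τ₀-ok : FPFInvolution τ₀
    τ₁-ok : FPFInvolution τ₁
    τ₂-ok : FPFInvolution τ₂
    τ₀τ₂-comm : ∀ x → τ₀ (τ₂ x) ≡ τ₂ (τ₀ x)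
    τ₀τ₂-noFix : ∀ x → ¬ τ₀ (τ₂ x) ≡ x
    vert : Fin nFlags → Fin nV
    edge : Fin nFlags → Fin nE
    face : Fin nFlags → Fin nFaces
    vert-ok : OrbitLabelling τ₁ τ₂ vert
    edge-ok : OrbitLabelling τ₀ τ₂ edge
    face-ok : OrbitLabelling τ₀ τ₁ face

module _ (G : EmbeddedGraph) where
  open EmbeddedGraph G

  Inc : Fin nE → Fin nV → Set
  Inc d v = ∃ λ x → edge x ≡ d × vert x ≡ v

  -- the dual edge d* is incident with the face (dual vertex) f
  Inc* : Fin nE → Fin nFaces → Set
  Inc* d f = ∃ λ x → edge x ≡ d × face x ≡ f

  NonLoop : Fin nE → Set
  NonLoop d = ∃ λ u → ∃ λ w → Inc d u × Inc d w × ¬ u ≡ w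

  -- vertex set of G*[F*]: endpoints of the dual edges of F
  DualVerts : Subset nE → Fin nFaces → Set
  DualVerts F f = ∃ λ d → d ∈ F × Inc* d f

  Border : Subset nE → Fin nV → Set
  Border F v = (∃ λ d → d ∈ F × Inc d v) × (∃ λ d → d ∉ F × Inc d v)

{-# OPTIONS --safe #-}
-- Let x be a flag of e at the vertex v and rotate around v, i.e. iterate τ₂τ₁
-- starting from τ₂ x.  Consecutive faces met on the way share the dual of
-- an edge at v, and the rotation only returns to the edge e after passing
-- through all edges at v: it cannot come back via τ₂ x (the word (τ₂τ₁)ⁱτ₂ is
-- fixed-point free) nor via the other end of e (e is not a loop).  So if
-- every edge at v lay in F, the two faces at e would stay connected in
-- G*[F*] - e*, and deleting e* would not change the components.

module Submission where

open import Defs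
open import Data.Nat using (ℕ; zero; suc; s≤s; _<_)
open import Data.Nat.Properties using (<-irrefl; n<1+n)
open import Data.Nat.GeneralisedArithmetic using (fold)
open import Data.Fin using (Fin; zero; suc; toℕ; _≟_)
open import Data.Fin.Properties using (any?; pigeonhole; suc-injective)
open import Data.Fin.Subset using (Subset; _∈_; _∉_)
open import Data.Fin.Subset.Properties using (_∈?_)
open import Data.Product using (Σ; ∃; _×_; _,_; proj₁; proj₂)
open import Data.Sum using (_⊎_; inj₁; inj₂)
open import Data.Unit using (⊤; tt)
open import Data.Empty using (⊥-elim)
open import Function using (_∘_)
open import Function.Definitions using (Injective)
open import Relation.Nullary using (¬_; Dec; yes; no)
open import Relation.Nullary.Decidable using (_×-dec_; _⊎-dec_; map′)
open import Relation.Binary.Definitions using (Decidable)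
open import Relation.Binary.Structures using (IsEquivalence)
open import Relation.Binary.PropositionalEquality
  using (_≡_; refl; sym; trans; cong; subst)
open import Relation.Binary.Construct.Closure.ReflexiveTransitive
  using (Star; ε; _◅_; _◅◅_; map; reverse; return; foldl; kleisliStar; _⋆)

module _ {n : ℕ} (R : Fin (suc n) → Fin (suc n) → Set) where

  -- Eliminating the vertex zero: a detour through it counts as one step.
  Bypass : Fin n → Fin n → Set
  Bypass a b = R (suc a) (suc b) ⊎ (R (suc a) zero × R zero (suc b))

  bypass⇒star : ∀ {a b} → Star Bypass a b → Star R (suc a) (suc b)
  bypass⇒star = kleisliStar suc unfold
    where
    unfold : ∀ {a b} → Bypass a b → Star R (suc a) (suc b)
    unfold (inj₁ r)        = return r
    unfold (inj₂ (r , r′)) = r ◅ r′ ◅ ε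

  PathTo : Fin (suc n) → Fin n → Set
  PathTo zero    b = ∃ λ c → R zero (suc c) × Star Bypass c b
  PathTo (suc a) b = Star Bypass a b

  star⇒pathTo : ∀ {x b} → Star R x (suc b) → PathTo x b
  star⇒pathTo ε        = ε
  star⇒pathTo (r ◅ rs) = cons r (star⇒pathTo rs)
    where
    cons : ∀ {x y b} → R x y → PathTo y b → PathTo x b
    cons {zero}  {zero}  _ p            = p
    cons {zero}  {suc c} r p            = c , r , p
    cons {suc a} {zero}  r (c , r′ , p) = inj₂ (r , r′) ◅ p
    cons {suc a} {suc c} r p            = inj₁ r ◅ p

  PathToZero : Fin (suc n) → Set
  PathToZero zero    = ⊤
  PathToZero (suc a) = ∃ λ c → Star Bypass a c × R (suc c) zero

  star⇒pathToZero : ∀ {x} → Star R x zero → PathToZero x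
  star⇒pathToZero ε        = tt
  star⇒pathToZero (r ◅ rs) = cons r (star⇒pathToZero rs)
    where
    cons : ∀ {x y} → R x y → PathToZero y → PathToZero x
    cons {zero}          _ _             = tt
    cons {suc a} {zero}  r _             = a , ε , r
    cons {suc a} {suc c} r (c′ , p , r′) = c′ , inj₁ r ◅ p , r′

star? : ∀ {n} {R : Fin n → Fin n → Set} → Decidable R → Decidable (Star R)
star? {zero}         _  ()
star? {suc n} {R} R? = reach
  where
  bypass? : Decidable (Star (Bypass R))
  bypass? = star? λ a b → R? (suc a) (suc b) ⊎-dec (R? (suc a) zero ×-dec R? zero (suc b))

  reach : Decidable (Star R)
  reach zero    zero    = yes ε
  reach (suc a) (suc b) = map′ (bypass⇒star R) (star⇒pathTo R) (bypass? a b)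
  reach zero    (suc b) =
    map′ (λ { (c , r , p) → r ◅ bypass⇒star R p }) (star⇒pathTo R)
         (any? λ c → R? zero (suc c) ×-dec bypass? c b)
  reach (suc a) zero    =
    map′ (λ { (c , p , r) → bypass⇒star R p ◅◅ return r }) (star⇒pathToZero R)
         (any? λ c → bypass? a c ×-dec R? (suc c) zero)

-- HasComponents Inc W S k unfolds to ClassLabelling W (Connected Inc S) k.
LabelsClasses : ∀ {n k} (W : Fin n → Set) → (Fin n → Fin n → Set) → (Σ (Fin n) W → Fin k) → Set
LabelsClasses W R c =
  ∀ x y → (c x ≡ c y → R (proj₁ x) (proj₁ y)) × (R (proj₁ x) (proj₁ y) → c x ≡ c y)

ClassLabelling : ∀ {n} → (Fin n → Set) → (Fin n → Fin n → Set) → ℕ → Set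
ClassLabelling {n} W R k =
  Σ (Σ (Fin n) W → Fin k) λ c → (∀ i → ∃ λ x → c x ≡ i) × LabelsClasses W R c

module _ {n k : ℕ} {W : Fin (suc n) → Set} {R : Fin (suc n) → Fin (suc n) → Set}
         (E : IsEquivalence R) where
  private
    module E = IsEquivalence E
    Restricted : Set
    Restricted = ClassLabelling (W ∘ suc) (λ a b → R (suc a) (suc b)) k

  extend-outside : Restricted → ¬ W zero → ClassLabelling W R k
  extend-outside (c , surj , fibre) ¬w = c′ , surj′ , fibre′
    where
    c′ : Σ (Fin (suc n)) W → Fin k
    c′ (zero  , w) = ⊥-elim (¬w w)
    c′ (suc a , w) = c (a , w)
    surj′ : ∀ i → ∃ λ x → c′ x ≡ i
    surj′ i with surj i
    ... | (a , w) , eq = (suc a , w) , eq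
    fibre′ : LabelsClasses W R c′
    fibre′ (zero  , w) _           = ⊥-elim (¬w w)
    fibre′ (suc a , _) (zero  , w) = ⊥-elim (¬w w)
    fibre′ (suc a , v) (suc b , w) = fibre (a , v) (b , w)

  extend-joining : Restricted → ∀ {j} → W (suc j) → R zero (suc j) → ClassLabelling W R k
  extend-joining (c , surj , fibre) {j} wj r = c′ , surj′ , fibre′
    where
    c′ : Σ (Fin (suc n)) W → Fin k
    c′ (zero  , _) = c (j , wj)
    c′ (suc a , w) = c (a , w)
    surj′ : ∀ i → ∃ λ x → c′ x ≡ i
    surj′ i with surj i
    ... | (a , w) , eq = (suc a , w) , eq
    via-j : ∀ a (w : W (suc a)) → (c (j , wj) ≡ c (a , w) → R zero (suc a))
                               × (R zero (suc a) → c (j , wj) ≡ c (a , w))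
    via-j a w = (E.trans r ∘ proj₁ (fibre (j , wj) (a , w)))
              , (proj₂ (fibre (j , wj) (a , w)) ∘ E.trans (E.sym r))
    fibre′ : LabelsClasses W R c′
    fibre′ (zero  , _) (zero  , _) = (λ _ → E.refl) , (λ _ → refl)
    fibre′ (zero  , _) (suc a , w) = via-j a w
    fibre′ (suc a , w) (zero  , _) = (E.sym ∘ proj₁ (via-j a w) ∘ sym)
                                   , (sym ∘ proj₂ (via-j a w) ∘ E.sym)
    fibre′ (suc a , v) (suc b , w) = fibre (a , v) (b , w)

  extend-fresh : Restricted → W zero → ¬ (∃ λ j → W (suc j) × R zero (suc j)) →
                 ClassLabelling W R (suc k)
  extend-fresh (c , surj , fibre) w₀ alone = c′ , surj′ , fibre′
    where
    c′ : Σ (Fin (suc n)) W → Fin (suc k)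
    c′ (zero  , _) = zero
    c′ (suc a , w) = suc (c (a , w))
    surj′ : ∀ i → ∃ λ x → c′ x ≡ i
    surj′ zero    = (zero , w₀) , refl
    surj′ (suc i) with surj i
    ... | (a , w) , eq = (suc a , w) , cong suc eq
    fibre′ : LabelsClasses W R c′
    fibre′ (zero  , _) (zero  , _) = (λ _ → E.refl) , (λ _ → refl)
    fibre′ (zero  , _) (suc a , w) = (λ ()) , (λ r → ⊥-elim (alone (a , w , r)))
    fibre′ (suc a , w) (zero  , _) = (λ ()) , (λ r → ⊥-elim (alone (a , w , E.sym r)))
    fibre′ (suc a , v) (suc b , w) = (proj₁ (fibre (a , v) (b , w)) ∘ suc-injective)
                                   , (cong suc ∘ proj₂ (fibre (a , v) (b , w)))

classes : ∀ {n} {W : Fin n → Set} {R : Fin n → Fin n → Set} →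
          (∀ a → Dec (W a)) → Decidable R → IsEquivalence R → ∃ (ClassLabelling W R)
classes {zero} _ _ _ = 0 , (λ { (() , _) }) , (λ ()) , λ { (() , _) }
classes {suc n} {W} {R} W? R? E
  with classes (W? ∘ suc) (λ a b → R? (suc a) (suc b)) restricted | W? zero
  where
  module E = IsEquivalence E
  restricted : IsEquivalence (λ a b → R (suc a) (suc b))
  restricted = record { refl = E.refl ; sym = E.sym ; trans = E.trans }
... | k , L | no ¬w = k , extend-outside E L ¬w
... | k , L | yes w with any? (λ j → W? (suc j) ×-dec R? zero (suc j))
...   | yes (j , wj , r) = k , extend-joining E L wj r
...   | no alone         = suc k , extend-fresh E L w alone

module _ {nv ne} {Inc : Fin ne → Fin nv → Set} where

  Adj-sym : ∀ {S u w} → Adj Inc S u w → Adj Inc S w u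
  Adj-sym (d , s , iu , iw) = d , s , iw , iu

  connected-isEquivalence : ∀ {S} → IsEquivalence (Connected Inc S)
  connected-isEquivalence = record { refl = ε ; sym = reverse Adj-sym ; trans = _◅◅_ }

  module _ {W : Fin nv → Set} {S : Fin ne → Set}
           (Inc? : ∀ d v → Dec (Inc d v)) (W? : ∀ v → Dec (W v)) (S? : ∀ d → Dec (S d))
           where

    connected? : Decidable (Connected Inc S)
    connected? = star? λ u w → any? λ d → S? d ×-dec (Inc? d u ×-dec Inc? d w)

    -- IsBridge only constrains existing labellings, so one has to be built;
    -- it then labels the components of S and of S minus d alike.
    ends-connected⇒¬bridge :
      ∀ {d} → (∀ {u w} → Inc d u → Inc d w → Connected Inc (Delete S d) u w) →
      ¬ IsBridge Inc W S d
    ends-connected⇒¬bridge {d} ends (_ , splits)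
      with classes W? connected? connected-isEquivalence
    ... | k , c , surj , fibre =
      <-irrefl refl (splits k k (c , surj , fibre) (c , surj , fibre′))
      where
      reroute : ∀ {u w} → Adj Inc S u w → Connected Inc (Delete S d) u w
      reroute (d′ , s , iu , iw) with d′ ≟ d
      ... | no d′≢d = return (d′ , (s , d′≢d) , iu , iw)
      ... | yes refl = ends iu iw
      fibre′ : LabelsClasses W (Connected Inc (Delete S d)) c
      fibre′ x y = (reroute ⋆ ∘ proj₁ (fibre x y))
                 , (proj₂ (fibre x y) ∘ map λ { (d′ , (s , _) , iu , iw) → d′ , s , iu , iw })

iterate-returns : ∀ {m} {f : Fin m → Fin m} → Injective _≡_ _≡_ f →
                  ∀ y → ∃ λ n → fold y f (suc n) ≡ y
iterate-returns {m} {f} f-inj y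
  with pigeonhole (n<1+n m) (fold y f ∘ toℕ)
... | i , j , i<j , eq = cancel (toℕ i) (toℕ j) i<j eq
  where
  cancel : ∀ i j → i < j → fold y f i ≡ fold y f j → ∃ λ n → fold y f (suc n) ≡ y
  cancel zero    (suc j) _         eq = j , sym eq
  cancel (suc i) (suc j) (s≤s i<j) eq = cancel i j i<j (f-inj eq)

-- (b a)ⁱ b is a palindrome, hence conjugate to a or b.
alternating-word-fixpoint-free :
  ∀ {m} {a b : Fin m → Fin m} → FPFInvolution a → FPFInvolution b →
  ∀ i w → ¬ fold (b w) (b ∘ a) i ≡ w
alternating-word-fixpoint-free _ b-ok zero w = FPFInvolution.noFix b-ok w
alternating-word-fixpoint-free {a = a} {b} a-ok b-ok (suc i) w eq =
  alternating-word-fixpoint-free b-ok a-ok i (b w)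
    (trans (sym (commute i (b w))) (trans (sym (FPFInvolution.invol b-ok _)) (cong b eq)))
  where
  commute : ∀ i v → a (fold v (b ∘ a) i) ≡ fold (a v) (a ∘ b) i
  commute zero    v = refl
  commute (suc i) v = cong (a ∘ b) (commute i v)

orbitLabelling-generators : ∀ {m n} {σ ρ : Fin m → Fin m} {lab : Fin m → Fin n} →
                            OrbitLabelling σ ρ lab → ∀ x → lab (σ x) ≡ lab x × lab (ρ x) ≡ lab x
orbitLabelling-generators (_ , fibre) x =
  sym (proj₂ (fibre x _) (return (inj₁ refl))) , sym (proj₂ (fibre x _) (return (inj₂ refl)))

module _ (G : EmbeddedGraph) where
  open EmbeddedGraph G
  open FPFInvolution

  vert-τ₁ : ∀ y → vert (τ₁ y) ≡ vert y
  vert-τ₁ = proj₁ ∘ orbitLabelling-generators vert-ok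
  vert-τ₂ : ∀ y → vert (τ₂ y) ≡ vert y
  vert-τ₂ = proj₂ ∘ orbitLabelling-generators vert-ok
  edge-τ₂ : ∀ y → edge (τ₂ y) ≡ edge y
  edge-τ₂ = proj₂ ∘ orbitLabelling-generators edge-ok
  face-τ₀ : ∀ y → face (τ₀ y) ≡ face y
  face-τ₀ = proj₁ ∘ orbitLabelling-generators face-ok
  face-τ₁ : ∀ y → face (τ₁ y) ≡ face y
  face-τ₁ = proj₂ ∘ orbitLabelling-generators face-ok

  vert-τ₀τ₂ : ∀ x → vert (τ₀ (τ₂ x)) ≡ vert (τ₀ x)
  vert-τ₀τ₂ x = trans (cong vert (τ₀τ₂-comm x)) (vert-τ₂ (τ₀ x))

  EdgeFlags : Fin nFlags → Fin nFlags → Set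
  EdgeFlags x y = y ≡ x ⊎ y ≡ τ₀ x ⊎ y ≡ τ₂ x ⊎ y ≡ τ₀ (τ₂ x)

  edgeFlags-step : ∀ {x y z} → EdgeFlags x y → Step τ₀ τ₂ y z → EdgeFlags x z
  edgeFlags-step (inj₁ refl) (inj₁ refl) = inj₂ (inj₁ refl)
  edgeFlags-step (inj₁ refl) (inj₂ refl) = inj₂ (inj₂ (inj₁ refl))
  edgeFlags-step {x} (inj₂ (inj₁ refl)) (inj₁ refl) = inj₁ (invol τ₀-ok x)
  edgeFlags-step {x} (inj₂ (inj₁ refl)) (inj₂ refl) = inj₂ (inj₂ (inj₂ (sym (τ₀τ₂-comm x))))
  edgeFlags-step (inj₂ (inj₂ (inj₁ refl))) (inj₁ refl) = inj₂ (inj₂ (inj₂ refl))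
  edgeFlags-step {x} (inj₂ (inj₂ (inj₁ refl))) (inj₂ refl) = inj₁ (invol τ₂-ok x)
  edgeFlags-step {x} (inj₂ (inj₂ (inj₂ refl))) (inj₁ refl) =
    inj₂ (inj₂ (inj₁ (invol τ₀-ok (τ₂ x))))
  edgeFlags-step {x} (inj₂ (inj₂ (inj₂ refl))) (inj₂ refl) =
    inj₂ (inj₁ (trans (sym (τ₀τ₂-comm (τ₂ x))) (cong τ₀ (invol τ₂-ok x))))

  same-edge⇒edgeFlags : ∀ {x y} → edge x ≡ edge y → EdgeFlags x y
  same-edge⇒edgeFlags {x} {y} eq =
    foldl EdgeFlags edgeFlags-step (inj₁ refl) (proj₁ (proj₂ edge-ok x y) eq)

  edgeFlags-vert : ∀ {x y} → EdgeFlags x y → vert y ≡ vert x ⊎ vert y ≡ vert (τ₀ x)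
  edgeFlags-vert (inj₁ refl)                   = inj₁ refl
  edgeFlags-vert (inj₂ (inj₁ refl))            = inj₂ refl
  edgeFlags-vert {x} (inj₂ (inj₂ (inj₁ refl))) = inj₁ (vert-τ₂ x)
  edgeFlags-vert {x} (inj₂ (inj₂ (inj₂ refl))) = inj₂ (vert-τ₀τ₂ x)

  edgeFlags-face : ∀ {x y} → EdgeFlags x y → face y ≡ face x ⊎ face y ≡ face (τ₂ x)
  edgeFlags-face (inj₁ refl)                   = inj₁ refl
  edgeFlags-face {x} (inj₂ (inj₁ refl))        = inj₁ (face-τ₀ x)
  edgeFlags-face (inj₂ (inj₂ (inj₁ refl)))     = inj₂ refl
  edgeFlags-face {x} (inj₂ (inj₂ (inj₂ refl))) = inj₂ (face-τ₀ (τ₂ x))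

  nonLoop⇒τ₀-moves-vert : ∀ {x} → NonLoop G (edge x) → ¬ vert (τ₀ x) ≡ vert x
  nonLoop⇒τ₀-moves-vert {x} (_ , _ , (y , ey , refl) , (y′ , ey′ , refl) , y≢y′) loop =
    y≢y′ (trans (collapse (same-edge⇒edgeFlags (sym ey)))
                (sym (collapse (same-edge⇒edgeFlags (sym ey′)))))
    where
    collapse : ∀ {y} → EdgeFlags x y → vert y ≡ vert x
    collapse f with edgeFlags-vert f
    ... | inj₁ eq = eq
    ... | inj₂ eq = trans eq loop

  dual-ends : ∀ {x f} → Inc* G (edge x) f → f ≡ face x ⊎ f ≡ face (τ₂ x)
  dual-ends (y , ey , refl) = edgeFlags-face (same-edge⇒edgeFlags (sym ey))

  rotate : Fin nFlags → Fin nFlags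
  rotate = τ₂ ∘ τ₁

  rotate-injective : Injective _≡_ _≡_ rotate
  rotate-injective {a} {b} eq =
    trans (sym (unrotate a)) (trans (cong (τ₁ ∘ τ₂) eq) (unrotate b))
    where
    unrotate : ∀ y → τ₁ (τ₂ (rotate y)) ≡ y
    unrotate y = trans (cong τ₁ (invol τ₂-ok (τ₁ y))) (invol τ₁-ok y)

  rotation : Fin nFlags → ℕ → Fin nFlags
  rotation x = fold (τ₂ x) rotate

  rotation-vert : ∀ x k → vert (rotation x k) ≡ vert x
  rotation-vert x zero    = vert-τ₂ x
  rotation-vert x (suc k) = trans (vert-τ₂ _) (trans (vert-τ₁ _) (rotation-vert x k))

  rotation-returns : ∀ x → ∃ λ n → rotation x n ≡ τ₁ x
  rotation-returns x with iterate-returns rotate-injective (τ₂ x)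
  ... | n , eq = n , rotate-injective (trans eq (cong τ₂ (sym (invol τ₁-ok x))))

  rotation-avoids-far-end : ∀ {x} k → NonLoop G (edge x) →
                            ¬ vert (τ₁ (rotation x k)) ≡ vert (τ₀ x)
  rotation-avoids-far-end {x} k nl eq = nonLoop⇒τ₀-moves-vert nl
    (trans (sym eq) (trans (vert-τ₁ _) (rotation-vert x k)))

  rotation-new-edge : ∀ {x} k → NonLoop G (edge x) → ¬ rotation x k ≡ τ₁ x →
                      ¬ edge (τ₁ (rotation x k)) ≡ edge x
  rotation-new-edge {x} k nl ≢τ₁x eq with same-edge⇒edgeFlags (sym eq)
  ... | inj₁ at-x = ≢τ₁x (trans (sym (invol τ₁-ok _)) (cong τ₁ at-x))
  ... | inj₂ (inj₁ at-τ₀x) = rotation-avoids-far-end k nl (cong vert at-τ₀x)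
  ... | inj₂ (inj₂ (inj₁ at-τ₂x)) =
    alternating-word-fixpoint-free τ₁-ok τ₂-ok (suc k) x
      (trans (cong τ₂ at-τ₂x) (invol τ₂-ok x))
  ... | inj₂ (inj₂ (inj₂ at-τ₀τ₂x)) =
    rotation-avoids-far-end k nl (trans (cong vert at-τ₀τ₂x) (vert-τ₀τ₂ x))

  inc*? : ∀ d f → Dec (Inc* G d f)
  inc*? d f = any? λ y → (edge y ≟ d) ×-dec (face y ≟ f)

  dualVerts? : ∀ F f → Dec (DualVerts G F f)
  dualVerts? F f = any? λ d → (d ∈? F) ×-dec inc*? d f

  module _ (F : Subset nE) where

    ConnectedAvoiding : Fin nE → Fin nFaces → Fin nFaces → Set
    ConnectedAvoiding e = Connected (Inc* G) (Delete (_∈ F) e)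

    EdgeOutsideAt : Fin nV → Set
    EdgeOutsideAt v = ∃ λ d → d ∉ F × Inc G d v

    rotate-adjacent : ∀ {e} y → edge (τ₁ y) ∈ F → ¬ edge (τ₁ y) ≡ e →
                      Adj (Inc* G) (Delete (_∈ F) e) (face y) (face (rotate y))
    rotate-adjacent y ∈F ≢e =
      edge (τ₁ y) , (∈F , ≢e) , (τ₁ y , refl , face-τ₁ y) , (rotate y , edge-τ₂ (τ₁ y) , refl)

    rotation-connects :
      ∀ {x} → NonLoop G (edge x) → ∀ k →
      (EdgeOutsideAt (vert x) ⊎ ConnectedAvoiding (edge x) (face (τ₂ x)) (face x))
      ⊎ ConnectedAvoiding (edge x) (face (τ₂ x)) (face (rotation x k))
    rotation-connects nl zero = inj₂ ε
    rotation-connects {x} nl (suc k) with rotation-connects nl k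
    ... | inj₁ done = inj₁ done
    ... | inj₂ path with rotation x k ≟ τ₁ x
    ...   | yes returned =
      inj₁ (inj₂ (subst (ConnectedAvoiding _ _) (trans (cong face returned) (face-τ₁ x)) path))
    ...   | no ≢τ₁x with edge (τ₁ (rotation x k)) ∈? F
    ...     | no ∉F =
      inj₁ (inj₁ (_ , ∉F , τ₁ (rotation x k) , refl , trans (vert-τ₁ _) (rotation-vert x k)))
    ...     | yes ∈F =
      inj₂ (path ◅◅ return (rotate-adjacent (rotation x k) ∈F (rotation-new-edge k nl ≢τ₁x)))

    around-vertex : ∀ {x} → NonLoop G (edge x) →
                    EdgeOutsideAt (vert x) ⊎ ConnectedAvoiding (edge x) (face (τ₂ x)) (face x)
    around-vertex {x} nl with rotation-returns x
    ... | n , returned with rotation-connects nl n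
    ...   | inj₁ done = done
    ...   | inj₂ path =
      inj₂ (subst (ConnectedAvoiding _ _) (trans (cong face returned) (face-τ₁ x)) path)

    dual-ends-connected :
      ∀ {x} → ConnectedAvoiding (edge x) (face (τ₂ x)) (face x) →
      ∀ {f f′} → Inc* G (edge x) f → Inc* G (edge x) f′ → ConnectedAvoiding (edge x) f f′
    dual-ends-connected path i i′ with dual-ends i | dual-ends i′
    ... | inj₁ refl | inj₁ refl = ε
    ... | inj₁ refl | inj₂ refl = reverse (Adj-sym {Inc = Inc* G}) path
    ... | inj₂ refl | inj₁ refl = path
    ... | inj₂ refl | inj₂ refl = ε

lemma4 : (G : EmbeddedGraph) (F : Subset (EmbeddedGraph.nE G))
         (e : Fin (EmbeddedGraph.nE G)) →
         e ∈ F → NonLoop G e →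
         IsBridge (Inc* G) (DualVerts G F) (λ d → d ∈ F) e →
         ∀ v → Inc G e v → Border G F v
lemma4 G F _ e∈F nl bridge _ (x , refl , refl) = (edge x , e∈F , x , refl , refl) , leaves
  where
  open EmbeddedGraph G using (edge; vert)
  leaves : EdgeOutsideAt G F (vert x)
  leaves with around-vertex G F nl
  ... | inj₁ found = found
  ... | inj₂ path  = ⊥-elim (ends-connected⇒¬bridge (inc*? G) (dualVerts? G F) (_∈? F)
                                                     (dual-ends-connected G F path) bridge)
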